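{- Let $G$ be a smallest counterexample to the statement "every $n$-vertex simple planar triangulation has an independent dominating set of size at most $n/3$" (i.e., $G$ is a simple planar triangulation with no independent dominating set of size at most $|V(G)|/3$, and every simple planar triangulation with fewer vertices has an independent dominating set of size at most one third of its number of vertices). Let $\psi$ be a partial proper $4$-coloring of $G$ such that every uncolored vertex has degree exactly four, $|\psi[v]|\ge 3$ for every vertex $v$, and $|\psi[v]| = 4$ for every vertex $v$ of degree at most five; let $\overline{C}$ be the set of uncolored vertices. For $i \in \{1,2,3,4\}$ let $C_i$ be the set of vertices colored $i$ and $U_i$ the set of vertices not in $C_i$ having no neighbor in $C_i$. Let $E_B$ be the set of edges of $G$ joining a vertex of $U_i$ to a vertex of $U_j$ for some $i \neq j$, let $V_B$ be the set of endpoints of edges in $E_B$, and let $G_B = (V_B, E_B)$. Then $G_B$ has a vertex cover of size at most $|\overline{C}|$.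
   Context: A triangulation is a simple plane graph in which every face, including the outer face, is bounded by a cycle of length three. A set $S \subseteq V(G)$ is an independent dominating set if no two vertices of $S$ are adjacent and every vertex of $G$ is in $S$ or has a neighbor in $S$. A partial proper $4$-coloring assigns colors from $\{1,2,3,4\}$ to some vertices so that adjacent colored vertices get distinct colors; $\psi[v]$ is the set of colors appearing on the closed neighborhood $N[v]=\{v\}\cup N(v)$. A vertex cover of a graph is a set of vertices meeting every edge. -}

module Defs where

open import Data.Nat using (ℕ; zero; suc; _+_; _*_; _≤_; _<_)
open import Data.Fin using (Fin; _≟_)
open import Data.Fin.Subset using (∣_∣)
open import Data.Fin.Properties using (any?)
open import Data.Vec using (tabulate)
open import Data.Bool using (Bool; true; false)
open import Data.Maybe using (Maybe; just; nothing; is-nothing)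
open import Data.Maybe.Properties using (≡-dec)
open import Data.Product using (Σ; ∃; ∃-syntax; _×_; _,_)
open import Data.Sum using (_⊎_)
open import Function using (_∘_)
open import Relation.Nullary using (¬_; Dec; yes; no)
open import Relation.Nullary.Decidable using (⌊_⌋; _×-dec_; _⊎-dec_)
open import Relation.Binary.PropositionalEquality using (_≡_; _≢_)

iter : ∀ {A : Set} → (A → A) → ℕ → A → A
iter f zero x = x
iter f (suc k) x = f (iter f k x)

data Reach {D : Set} (α σ σ⁻ : D → D) : D → D → Set where
  here  : ∀ {d} → Reach α σ σ⁻ d d
  via-α : ∀ {d e} → Reach α σ σ⁻ (α d) e → Reach α σ σ⁻ d e
  via-σ : ∀ {d e} → Reach α σ σ⁻ (σ d) e → Reach α σ σ⁻ d e
  via-σ⁻ : ∀ {d e} → Reach α σ σ⁻ (σ⁻ d) e → Reach α σ σ⁻ d e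

-- A simple plane (spherical) triangulation on the vertex set Fin n, given
-- as a combinatorial map (rotation system): 2m darts (half-edges),
-- α = edge involution, σ = rotation around vertices, faces = orbits of σ ∘ α.
-- Planarity (genus 0) is expressed by Euler's formula n - m + f = 2 for the
-- connected map; every face is a triangle (orbit of length exactly 3).
record Triangulation (n : ℕ) : Set where
  field
    m     : ℕ
    α σ σ⁻ : Fin (2 * m) → Fin (2 * m)
    vert  : Fin (2 * m) → Fin n     -- tail vertex of a dart
    α-invol  : ∀ d → α (α d) ≡ d
    α-fpf    : ∀ d → α d ≢ d
    σ-inv₁   : ∀ d → σ (σ⁻ d) ≡ d
    σ-inv₂   : ∀ d → σ⁻ (σ d) ≡ d
    vert-orbit₁ : ∀ d e → vert d ≡ vert e → ∃[ k ] iter σ k d ≡ e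
    vert-orbit₂ : ∀ d e k → iter σ k d ≡ e → vert d ≡ vert e
    vert-surj   : ∀ v → ∃[ d ] vert d ≡ v
    connected : ∀ d e → Reach α σ σ⁻ d e
    face-tri  : ∀ d → (σ ∘ α) ((σ ∘ α) ((σ ∘ α) d)) ≡ d
    face-nfix : ∀ d → (σ ∘ α) d ≢ d
    no-loop  : ∀ d → vert (α d) ≢ vert d
    no-multi : ∀ d e → vert d ≡ vert e → vert (α d) ≡ vert (α e) → d ≡ e
    faces       : ℕ
    faces-count : 3 * faces ≡ 2 * m
    euler       : n + faces ≡ m + 2

open Triangulation public

module _ {n : ℕ} (G : Triangulation n) where

  Adj : Fin n → Fin n → Set
  Adj u v = ∃[ d ] (vert G d ≡ u × vert G (α G d) ≡ v)

  adj? : ∀ u v → Dec (Adj u v)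
  adj? u v = any? (λ d → (vert G d ≟ u) ×-dec (vert G (α G d) ≟ v))

count : ∀ {k} → (Fin k → Bool) → ℕ
count f = ∣ tabulate f ∣

degree : ∀ {n} → Triangulation n → Fin n → ℕ
degree G u = count (λ v → ⌊ adj? G u v ⌋)

IndependentDominating : ∀ {n} → Triangulation n → (Fin n → Bool) → Set
IndependentDominating G S =
  (∀ u v → S u ≡ true → S v ≡ true → ¬ Adj G u v) ×
  (∀ v → S v ≡ true ⊎ ∃[ u ] (Adj G v u × S u ≡ true))

HasSmallIDS : ∀ {n} → Triangulation n → Set
HasSmallIDS {n} G = ∃[ S ] (IndependentDominating G S × 3 * count S ≤ n)

-- partial 4-colorings: nothing = uncolored
Coloring : ℕ → Set
Coloring n = Fin n → Maybe (Fin 4)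

Proper : ∀ {n} → Triangulation n → Coloring n → Set
Proper G ψ = ∀ u v c → Adj G u v → ψ u ≡ just c → ψ v ≢ just c

InPsi : ∀ {n} → Triangulation n → Coloring n → Fin n → Fin 4 → Set
InPsi G ψ v c = ψ v ≡ just c ⊎ ∃[ u ] (Adj G v u × ψ u ≡ just c)

inPsi? : ∀ {n} (G : Triangulation n) ψ v c → Dec (InPsi G ψ v c)
inPsi? G ψ v c = ≡-dec _≟_ (ψ v) (just c)
  ⊎-dec any? (λ u → adj? G v u ×-dec ≡-dec _≟_ (ψ u) (just c))

psiSize : ∀ {n} → Triangulation n → Coloring n → Fin n → ℕ
psiSize G ψ v = count (λ c → ⌊ inPsi? G ψ v c ⌋)

uncolored : ∀ {n} → Coloring n → ℕ
uncolored ψ = count (λ v → is-nothing (ψ v))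

InU : ∀ {n} → Triangulation n → Coloring n → Fin 4 → Fin n → Set
InU G ψ i v = ψ v ≢ just i × (∀ u → Adj G v u → ψ u ≢ just i)

EB : ∀ {n} → Triangulation n → Coloring n → Fin n → Fin n → Set
EB G ψ u v = Adj G u v × ∃[ i ] ∃[ j ] (i ≢ j × InU G ψ i u × InU G ψ j v)

VB : ∀ {n} → Triangulation n → Coloring n → Fin n → Set
VB G ψ v = ∃[ u ] (EB G ψ v u ⊎ EB G ψ u v)

VertexCoverB : ∀ {n} → Triangulation n → Coloring n → (Fin n → Bool) → Set
VertexCoverB G ψ X =
  (∀ v → X v ≡ true → VB G ψ v) ×
  (∀ u v → EB G ψ u v → X u ≡ true ⊎ X v ≡ true)

{-# OPTIONS --safe #-}
module Submission where

-- Let X be the set of vertices of G_B that have colour 0 or lie in U₀.  The ends u ∈ U_i and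
-- v ∈ U_j of an edge of E_B are coloured (an uncoloured vertex has degree 4, so it sees all
-- four colours), and ψ u, ψ v, i, j are four distinct colours; one of them is 0, so X covers
-- E_B.  A common neighbour of u and v would need a fifth colour, so it is uncoloured, and as
-- u has degree > 5 the two faces at uv give two such neighbours: every vertex of X has at
-- least two uncoloured neighbours.  An uncoloured vertex x has degree 4 and a neighbour a of
-- colour 0; no vertex of X is adjacent to a, which rules out the two common neighbours of
-- x and a, so x has at most two neighbours in X.  Double counting gives |X| ≤ |C̄|.

open import Defs
open import Data.Nat using (ℕ; zero; suc; _+_; _*_; _≤_; _<_; _≤?_; z≤n; s≤s; NonZero)
open import Data.Nat.Properties
  using (≤-trans; ≤-reflexive; <-irrefl; <-trans; <-≤-trans; ≰⇒>; ≤⇒≯; n≤1+n; n≤0⇒n≡0; m+n≤o⇒m≤o;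
         +-suc; +-mono-≤; +-monoʳ-≤; +-cancelˡ-≤; *-cancelˡ-≤; *-identityʳ; *-zeroʳ; +-*-semiring; module ≤-Reasoning)
open import Data.Fin using (Fin; zero; suc; _≟_)
open import Data.Fin.Properties using (any?; all?)
open import Data.Fin.Subset using (Subset; inside; outside; ∣_∣; _∈_; _∉_; _⊆_; _∪_; _-_; ⁅_⁆; ⊥)
open import Data.Fin.Subset.Properties
  using (∣p∣≡n⇒p≡⊤; p⊆q⇒∣p∣≤∣q∣; x∈p⇒∣p-x∣<∣p∣; x∈p∧x≢y⇒x∈p-y; ∣⁅x⁆∣≡1; x∈⁅x⁆; x∈p∪q⁺; ∣⊥∣≡0; ∉⊥; ⊥⊆; ∈⊤; ∣⊤∣≡n)
open import Data.Vec using ([]; _∷_; tabulate)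
open import Data.Vec.Properties using (lookup∘tabulate; lookup⇒[]=; []=⇒lookup)
open import Data.Bool using (Bool; true; false; if_then_else_)
open import Data.Maybe using (Maybe; just; nothing; is-nothing)
open import Data.Maybe.Properties using (≡-dec)
open import Data.List using (List; []; _∷_; length)
open import Data.List.Relation.Unary.All using (All; []; _∷_)
import Data.List.Relation.Unary.All as All
open import Data.List.Relation.Unary.All.Properties using (¬Any⇒All¬)
open import Data.List.Relation.Unary.AllPairs using ([]; _∷_)
open import Data.List.Relation.Unary.Any using (here; there)
import Data.List.Relation.Unary.Any as Any
open import Data.List.Relation.Unary.Unique.Propositional using (Unique)
open import Data.List.Membership.Propositional using () renaming (_∈_ to _∈ₗ_)
open import Data.Product using (∃-syntax; ∃₂; _×_; _,_; proj₁; proj₂)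
open import Data.Sum using (_⊎_; inj₁; inj₂)
import Data.Sum as Sum
open import Function using (_∘_; _$_)
open import Relation.Nullary using (¬_; Dec; yes; no; contradiction)
open import Relation.Nullary.Decidable using (⌊_⌋; _×-dec_; _⊎-dec_; ¬?; _→-dec_)
open import Relation.Binary.PropositionalEquality
open import Algebra.Properties.Semiring.Sum +-*-semiring using (sum-syntax; sum-cong-≗; ∑-comm; *-distribˡ-sum)

toWitness≡ : ∀ {A : Set} (a? : Dec A) → ⌊ a? ⌋ ≡ true → A
toWitness≡ (yes a) _ = a

fromWitness≡ : ∀ {A : Set} (a? : Dec A) → A → ⌊ a? ⌋ ≡ true
fromWitness≡ (yes _) _ = refl
fromWitness≡ (no ¬a) a = contradiction a ¬a

≢nothing⇒≡just : ∀ {A : Set} (x : Maybe A) → x ≢ nothing → ∃[ a ] x ≡ just a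
≢nothing⇒≡just (just a) _         = a , refl
≢nothing⇒≡just nothing  x≢nothing = contradiction refl x≢nothing

≢just⇒≡nothing : ∀ {A : Set} (x : Maybe A) → (∀ a → x ≢ just a) → x ≡ nothing
≢just⇒≡nothing (just a) x≢just = contradiction refl (x≢just a)
≢just⇒≡nothing nothing  _      = refl

is-nothing⇒≡nothing : ∀ {A : Set} (x : Maybe A) → is-nothing x ≡ true → x ≡ nothing
is-nothing⇒≡nothing nothing _ = refl

∈-tabulate⁺ : ∀ {k} {f : Fin k → Bool} {i} → f i ≡ true → i ∈ tabulate f
∈-tabulate⁺ {f = f} {i} fi = lookup⇒[]= i (tabulate f) (trans (lookup∘tabulate f i) fi)

∈-tabulate⁻ : ∀ {k} {f : Fin k → Bool} {i} → i ∈ tabulate f → f i ≡ true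
∈-tabulate⁻ {f = f} {i} i∈f = trans (sym (lookup∘tabulate f i)) ([]=⇒lookup i∈f)

∣p∪q∣≤∣p∣+∣q∣ : ∀ {n} (p q : Subset n) → ∣ p ∪ q ∣ ≤ ∣ p ∣ + ∣ q ∣
∣p∪q∣≤∣p∣+∣q∣ []            []            = z≤n
∣p∪q∣≤∣p∣+∣q∣ (outside ∷ p) (outside ∷ q) = ∣p∪q∣≤∣p∣+∣q∣ p q
∣p∪q∣≤∣p∣+∣q∣ (outside ∷ p) (inside  ∷ q) = ≤-trans (s≤s (∣p∪q∣≤∣p∣+∣q∣ p q)) (≤-reflexive (sym (+-suc ∣ p ∣ ∣ q ∣)))
∣p∪q∣≤∣p∣+∣q∣ (inside  ∷ p) (outside ∷ q) = s≤s (∣p∪q∣≤∣p∣+∣q∣ p q)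
∣p∪q∣≤∣p∣+∣q∣ (inside  ∷ p) (inside  ∷ q) = s≤s (≤-trans (∣p∪q∣≤∣p∣+∣q∣ p q) (+-monoʳ-≤ ∣ p ∣ (n≤1+n ∣ q ∣)))

length+∣q∣≤∣p∣ : ∀ {n} {xs : List (Fin n)} {p q : Subset n} →
                 Unique xs → All (_∈ p) xs → All (_∉ q) xs → q ⊆ p → length xs + ∣ q ∣ ≤ ∣ p ∣
length+∣q∣≤∣p∣ [] [] [] q⊆p = p⊆q⇒∣p∣≤∣q∣ q⊆p
length+∣q∣≤∣p∣ {xs = x ∷ xs} {p} {q} (x≢xs ∷ xs-unique) (x∈p ∷ xs⊆p) (x∉q ∷ xs∉q) q⊆p =
  ≤-trans (s≤s (length+∣q∣≤∣p∣ xs-unique xs⊆p-x xs∉q q⊆p-x)) (x∈p⇒∣p-x∣<∣p∣ x∈p)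
  where
  xs⊆p-x : All (_∈ p - x) xs
  xs⊆p-x = All.zipWith (λ (y∈p , x≢y) → x∈p∧x≢y⇒x∈p-y y∈p (x≢y ∘ sym)) (xs⊆p , x≢xs)
  q⊆p-x : q ⊆ p - x
  q⊆p-x y∈q = x∈p∧x≢y⇒x∈p-y (q⊆p y∈q) (λ { refl → x∉q y∈q })

length≤∣p∣ : ∀ {n} {xs : List (Fin n)} {p : Subset n} → Unique xs → All (_∈ p) xs → length xs ≤ ∣ p ∣
length≤∣p∣ {xs = xs} xs-unique xs⊆p =
  m+n≤o⇒m≤o (length xs) (length+∣q∣≤∣p∣ xs-unique xs⊆p (All.map (λ _ → ∉⊥) xs⊆p) ⊥⊆)

Unique-complete : ∀ {k} {xs : List (Fin k)} → Unique xs → length xs ≡ k → ∀ x → x ∈ₗ xs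
Unique-complete {k} {xs} xs-unique len≡k x with Any.any? (x ≟_) xs
... | yes x∈xs = x∈xs
... | no  x∉xs = contradiction (length≤∣p∣ (¬Any⇒All¬ xs x∉xs ∷ xs-unique) (All.tabulate (λ _ → ∈⊤)))
                               (<-irrefl (trans len≡k (sym (∣⊤∣≡n k))))

count-full : ∀ {k} (f : Fin k → Bool) → count f ≡ k → ∀ i → f i ≡ true
count-full f count≡k i = ∈-tabulate⁻ (subst (i ∈_) (sym (∣p∣≡n⇒p≡⊤ count≡k)) ∈⊤)

count≤2 : ∀ {k} {f : Fin k → Bool} (a b : Fin k) → (∀ i → f i ≡ true → i ≡ a ⊎ i ≡ b) → count f ≤ 2
count≤2 {f = f} a b f⊆ab = begin
  count f                   ≤⟨ p⊆q⇒∣p∣≤∣q∣ f⊆a∪b ⟩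
  ∣ ⁅ a ⁆ ∪ ⁅ b ⁆ ∣          ≤⟨ ∣p∪q∣≤∣p∣+∣q∣ ⁅ a ⁆ ⁅ b ⁆ ⟩
  ∣ ⁅ a ⁆ ∣ + ∣ ⁅ b ⁆ ∣      ≡⟨ cong₂ _+_ (∣⁅x⁆∣≡1 a) (∣⁅x⁆∣≡1 b) ⟩
  2                         ∎
  where
  open ≤-Reasoning
  f⊆a∪b : tabulate f ⊆ ⁅ a ⁆ ∪ ⁅ b ⁆
  f⊆a∪b = x∈p∪q⁺ ∘ Sum.map (λ { refl → x∈⁅x⁆ a }) (λ { refl → x∈⁅x⁆ b }) ∘ f⊆ab _ ∘ ∈-tabulate⁻

length≤count : ∀ {k} {f : Fin k → Bool} {xs : List (Fin k)} →
               Unique xs → All (λ i → f i ≡ true) xs → length xs ≤ count f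
length≤count xs-unique xs⊆f = length≤∣p∣ xs-unique (All.map ∈-tabulate⁺ xs⊆f)

length+count≤count : ∀ {k} {f g : Fin k → Bool} {xs : List (Fin k)} →
                     Unique xs → All (λ i → f i ≡ true) xs → All (λ i → g i ≢ true) xs →
                     (∀ i → g i ≡ true → f i ≡ true) → length xs + count g ≤ count f
length+count≤count xs-unique xs⊆f xs∉g g⊆f =
  length+∣q∣≤∣p∣ xs-unique (All.map ∈-tabulate⁺ xs⊆f) (All.map (λ gi≢true → gi≢true ∘ ∈-tabulate⁻) xs∉g)
                 (∈-tabulate⁺ ∘ g⊆f _ ∘ ∈-tabulate⁻)

count-none : ∀ {k} {f : Fin k → Bool} → (∀ i → f i ≢ true) → count f ≡ 0
count-none {k} {f} f≢true = n≤0⇒n≡0 (subst (count f ≤_) (∣⊥∣≡0 k) (p⊆q⇒∣p∣≤∣q∣ f⊆⊥))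
  where
  f⊆⊥ : tabulate f ⊆ ⊥
  f⊆⊥ i∈f = contradiction (∈-tabulate⁻ i∈f) (f≢true _)

indicator : Bool → ℕ
indicator b = if b then 1 else 0

count≡∑ : ∀ {k} (f : Fin k → Bool) → count f ≡ ∑[ i < k ] indicator (f i)
count≡∑ {zero}  f = refl
count≡∑ {suc k} f with f zero
... | true  = cong suc (count≡∑ (f ∘ suc))
... | false = count≡∑ (f ∘ suc)

∑-mono-≤ : ∀ {k} {f g : Fin k → ℕ} → (∀ i → f i ≤ g i) → ∑[ i < k ] f i ≤ ∑[ i < k ] g i
∑-mono-≤ {zero}  f≤g = z≤n
∑-mono-≤ {suc k} f≤g = +-mono-≤ (f≤g zero) (∑-mono-≤ (f≤g ∘ suc))

double-counting : ∀ {k l} d .{{_ : NonZero d}} (f : Fin k → Bool) (g : Fin l → Bool) (r : Fin k → Fin l → Bool) →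
                  (∀ v x → r v x ≡ true → g x ≡ true) →
                  (∀ v → f v ≡ true → d ≤ count (r v)) →
                  (∀ x → g x ≡ true → count (λ v → r v x) ≤ d) →
                  count f ≤ count g
double-counting {k} {l} d f g r r⇒g rows columns = *-cancelˡ-≤ d $ begin
  d * count f                                   ≡⟨ cong (d *_) (count≡∑ f) ⟩
  d * ∑[ v < k ] indicator (f v)                ≡⟨ *-distribˡ-sum d (indicator ∘ f) ⟩
  ∑[ v < k ] (d * indicator (f v))              ≤⟨ ∑-mono-≤ row-bound ⟩
  ∑[ v < k ] count (r v)                        ≡⟨ sum-cong-≗ (count≡∑ ∘ r) ⟩
  ∑[ v < k ] ∑[ x < l ] indicator (r v x)       ≡⟨ ∑-comm (λ v x → indicator (r v x)) ⟩
  ∑[ x < l ] ∑[ v < k ] indicator (r v x)       ≡⟨ sum-cong-≗ (λ x → count≡∑ (λ v → r v x)) ⟨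
  ∑[ x < l ] count (λ v → r v x)                ≤⟨ ∑-mono-≤ column-bound ⟩
  ∑[ x < l ] (d * indicator (g x))              ≡⟨ *-distribˡ-sum d (indicator ∘ g) ⟨
  d * ∑[ x < l ] indicator (g x)                ≡⟨ cong (d *_) (count≡∑ g) ⟨
  d * count g                                   ∎
  where
  open ≤-Reasoning
  row-bound : ∀ v → d * indicator (f v) ≤ count (r v)
  row-bound v with f v in fv
  ... | true  = subst (_≤ count (r v)) (sym (*-identityʳ d)) (rows v fv)
  ... | false = subst (_≤ count (r v)) (sym (*-zeroʳ d)) z≤n
  column-bound : ∀ x → count (λ v → r v x) ≤ d * indicator (g x)
  column-bound x with g x in gx
  ... | true  = subst (count (λ v → r v x) ≤_) (sym (*-identityʳ d)) (columns x gx)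
  ... | false = ≤-reflexive (trans (count-none (λ v rvx → contradiction (trans (sym (r⇒g v x rvx)) gx) λ ()))
                                    (sym (*-zeroʳ d)))

iter-involution : ∀ {A : Set} {f : A → A} {x : A} → f (f x) ≡ x → ∀ k → iter f k x ≡ x ⊎ iter f k x ≡ f x
iter-involution ffx≡x zero = inj₁ refl
iter-involution {f = f} ffx≡x (suc k) with iter-involution ffx≡x k
... | inj₁ fᵏx≡x  = inj₂ (cong f fᵏx≡x)
... | inj₂ fᵏx≡fx = inj₁ (trans (cong f fᵏx≡fx) ffx≡x)

module _ {n : ℕ} (G : Triangulation n) where

  Adj-sym : ∀ {u v} → Adj G u v → Adj G v u
  Adj-sym (d , refl , refl) = α G d , refl , cong (vert G) (α-invol G d)

  CommonNeighbour : Fin n → Fin n → Fin n → Set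
  CommonNeighbour u v w = Adj G u w × Adj G v w

  φ : Fin (2 * m G) → Fin (2 * m G)
  φ = σ G ∘ α G

  vert-σ : ∀ d → vert G (σ G d) ≡ vert G d
  vert-σ d = sym (vert-orbit₂ G d (σ G d) 1 refl)

  vert-φ : ∀ d → vert G (φ d) ≡ vert G (α G d)
  vert-φ d = vert-σ (α G d)

  apex : Fin (2 * m G) → Fin n
  apex d = vert G (φ (φ d))

  vert-αφφ : ∀ d → vert G (α G (φ (φ d))) ≡ vert G d
  vert-αφφ d = trans (sym (vert-φ (φ (φ d)))) (cong (vert G) (face-tri G d))

  apex-α≡vert-ασ : ∀ d → apex (α G d) ≡ vert G (α G (σ G d))
  apex-α≡vert-ασ d = trans (cong (λ e → vert G (φ (σ G e))) (α-invol G d)) (vert-φ (σ G d))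

  apex-common : ∀ d → CommonNeighbour (vert G d) (vert G (α G d)) (apex d)
  apex-common d = (α G (φ (φ d)) , vert-αφφ d , cong (vert G) (α-invol G (φ (φ d))))
                , (φ d , vert-φ d , sym (vert-φ (φ d)))

  σ²≡id⇒degree≤2 : ∀ d → σ G (σ G d) ≡ d → degree G (vert G d) ≤ 2
  σ²≡id⇒degree≤2 d σ²d≡d = count≤2 (vert G (α G d)) (vert G (α G (σ G d))) neighbour
    where
    neighbour : ∀ v → ⌊ adj? G (vert G d) v ⌋ ≡ true → v ≡ vert G (α G d) ⊎ v ≡ vert G (α G (σ G d))
    neighbour v adj with toWitness≡ (adj? G (vert G d) v) adj
    ... | e , vert-e , refl with vert-orbit₁ G d e (sym vert-e)
    ... | k , σᵏd≡e with iter-involution σ²d≡d k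
    ... | inj₁ σᵏd≡d  = inj₁ (cong (vert G ∘ α G) (trans (sym σᵏd≡e) σᵏd≡d))
    ... | inj₂ σᵏd≡σd = inj₂ (cong (vert G ∘ α G) (trans (sym σᵏd≡e) σᵏd≡σd))

  -- α (φ (φ d)) and σ d both lead from vert d to the common apex, so simplicity identifies them.
  apex≡apex-α⇒σ²≡id : ∀ d → apex d ≡ apex (α G d) → σ G (σ G d) ≡ d
  apex≡apex-α⇒σ²≡id d same-apex = begin
    σ G (σ G d)              ≡⟨ cong (σ G) αφφd≡σd ⟨
    σ G (α G (φ (φ d)))      ≡⟨ face-tri G d ⟩
    d                        ∎
    where
    open ≡-Reasoning
    αφφd≡σd : α G (φ (φ d)) ≡ σ G d
    αφφd≡σd = no-multi G _ _ (trans (vert-αφφ d) (sym (vert-σ d)))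
      (trans (cong (vert G) (α-invol G _)) (trans same-apex (apex-α≡vert-ασ d)))

  two-common-neighbours : ∀ {u v} → Adj G u v → 2 < degree G u →
                          ∃₂ λ w w′ → w ≢ w′ × CommonNeighbour u v w × CommonNeighbour u v w′
  two-common-neighbours (d , refl , refl) 2<deg =
    apex d , apex (α G d) , apexes-distinct , apex-common d , other-side
    where
    apexes-distinct : apex d ≢ apex (α G d)
    apexes-distinct same = <-irrefl refl (<-≤-trans 2<deg (σ²≡id⇒degree≤2 d (apex≡apex-α⇒σ²≡id d same)))
    other-side : CommonNeighbour (vert G d) (vert G (α G d)) (apex (α G d))
    other-side with apex-common (α G d)
    ... | αd~apex , ααd~apex = subst (λ x → Adj G x (apex (α G d))) (cong (vert G) (α-invol G d)) ααd~apex , αd~apex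

module VertexCover {n : ℕ} (G : Triangulation n) (ψ : Coloring n) (proper : Proper G ψ)
  (uncoloured⇒degree≡4 : ∀ v → ψ v ≡ nothing → degree G v ≡ 4)
  (small-degree⇒psi≡4 : ∀ v → degree G v ≤ 5 → psiSize G ψ v ≡ 4) where

  coloured? : ∀ v c → Dec (ψ v ≡ c)
  coloured? v c = ≡-dec _≟_ (ψ v) c

  InU? : ∀ i v → Dec (InU G ψ i v)
  InU? i v = ¬? (coloured? v (just i)) ×-dec all? (λ u → adj? G v u →-dec ¬? (coloured? u (just i)))

  EB? : ∀ u v → Dec (EB G ψ u v)
  EB? u v = adj? G u v ×-dec any? (λ i → any? (λ j → ¬? (i ≟ j) ×-dec InU? i u ×-dec InU? j v))

  VB? : ∀ v → Dec (VB G ψ v)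
  VB? v = any? (λ u → EB? v u ⊎-dec EB? u v)

  EB-sym : ∀ {u v} → EB G ψ u v → EB G ψ v u
  EB-sym (u~v , i , j , i≢j , u∈Uᵢ , v∈Uⱼ) = Adj-sym G u~v , j , i , i≢j ∘ sym , v∈Uⱼ , u∈Uᵢ

  VB⇒EB : ∀ {v} → VB G ψ v → ∃[ u ] EB G ψ v u
  VB⇒EB (u , inj₁ vu) = u , vu
  VB⇒EB (u , inj₂ uv) = u , EB-sym uv

  palette-full : ∀ {v} → degree G v ≤ 5 → ∀ c → InPsi G ψ v c
  palette-full {v} deg≤5 c =
    toWitness≡ (inPsi? G ψ v c) (count-full (λ c → ⌊ inPsi? G ψ v c ⌋) (small-degree⇒psi≡4 v deg≤5) c)

  InU⇒5<degree : ∀ {i v} → InU G ψ i v → 5 < degree G v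
  InU⇒5<degree {i} {v} (ψv≢i , no-i-neighbour) with degree G v ≤? 5
  ... | no deg≰5 = ≰⇒> deg≰5
  ... | yes deg≤5 with palette-full deg≤5 i
  ...   | inj₁ ψv≡i              = contradiction ψv≡i ψv≢i
  ...   | inj₂ (u , v~u , ψu≡i) = contradiction ψu≡i (no-i-neighbour u v~u)

  InU⇒coloured : ∀ {i v} → InU G ψ i v → ∃[ c ] ψ v ≡ just c
  InU⇒coloured {v = v} v∈Uᵢ = ≢nothing⇒≡just (ψ v) λ ψv≡nothing →
    ≤⇒≯ (n≤1+n 4) (subst (5 <_) (uncoloured⇒degree≡4 v ψv≡nothing) (InU⇒5<degree v∈Uᵢ))

  record EBColours (u v : Fin n) : Set where
    field
      cᵤ cᵥ i j : Fin 4
      ψu≡cᵤ    : ψ u ≡ just cᵤ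
      ψv≡cᵥ    : ψ v ≡ just cᵥ
      u∈Uᵢ     : InU G ψ i u
      v∈Uⱼ     : InU G ψ j v
      distinct : Unique (cᵤ ∷ cᵥ ∷ i ∷ j ∷ [])

  EB-colours : ∀ {u v} → EB G ψ u v → EBColours u v
  EB-colours {u} {v} (u~v , i , j , i≢j , u∈Uᵢ , v∈Uⱼ)
    with InU⇒coloured u∈Uᵢ | InU⇒coloured v∈Uⱼ
  ... | cᵤ , ψu≡cᵤ | cᵥ , ψv≡cᵥ = record
    { cᵤ = cᵤ ; cᵥ = cᵥ ; i = i ; j = j ; ψu≡cᵤ = ψu≡cᵤ ; ψv≡cᵥ = ψv≡cᵥ ; u∈Uᵢ = u∈Uᵢ ; v∈Uⱼ = v∈Uⱼ
    ; distinct = (cᵤ≢cᵥ ∷ cᵤ≢i ∷ cᵤ≢j ∷ []) ∷ (cᵥ≢i ∷ cᵥ≢j ∷ []) ∷ (i≢j ∷ []) ∷ [] ∷ [] }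
    where
    cᵤ≢cᵥ : cᵤ ≢ cᵥ
    cᵤ≢cᵥ refl = proper u v cᵤ u~v ψu≡cᵤ ψv≡cᵥ
    cᵤ≢i : cᵤ ≢ i
    cᵤ≢i refl = proj₁ u∈Uᵢ ψu≡cᵤ
    cᵤ≢j : cᵤ ≢ j
    cᵤ≢j refl = proj₂ v∈Uⱼ u (Adj-sym G u~v) ψu≡cᵤ
    cᵥ≢i : cᵥ ≢ i
    cᵥ≢i refl = proj₂ u∈Uᵢ v u~v ψv≡cᵥ
    cᵥ≢j : cᵥ ≢ j
    cᵥ≢j refl = proj₁ v∈Uⱼ ψv≡cᵥ

  EB-common-neighbour-uncoloured : ∀ {u v w} → EB G ψ u v → CommonNeighbour G u v w → ψ w ≡ nothing
  EB-common-neighbour-uncoloured {u} {v} {w} uv (u~w , v~w) = ≢just⇒≡nothing (ψ w) colour-unused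
    where
    open EBColours (EB-colours uv)
    colour-unused : ∀ c → ψ w ≢ just c
    colour-unused c ψw≡c with Unique-complete distinct refl c
    ... | here refl                         = proper u w _ u~w ψu≡cᵤ ψw≡c
    ... | there (here refl)                 = proper v w _ v~w ψv≡cᵥ ψw≡c
    ... | there (there (here refl))         = proj₂ u∈Uᵢ w u~w ψw≡c
    ... | there (there (there (here refl))) = proj₂ v∈Uⱼ w v~w ψw≡c

  InX : Fin n → Set
  InX v = VB G ψ v × (ψ v ≡ just zero ⊎ InU G ψ zero v)

  InX? : ∀ v → Dec (InX v)
  InX? v = VB? v ×-dec (coloured? v (just zero) ⊎-dec InU? zero v)

  InX⇒no-zero-neighbour : ∀ {v a} → InX v → Adj G v a → ψ a ≢ just zero
  InX⇒no-zero-neighbour {v} {a} (_ , inj₁ ψv≡0) v~a = proper v a zero v~a ψv≡0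
  InX⇒no-zero-neighbour {v} {a} (_ , inj₂ v∈U₀) v~a = proj₂ v∈U₀ a v~a

  EB⇒InX : ∀ {u v} → EB G ψ u v → InX u ⊎ InX v
  EB⇒InX {u} {v} uv = zero-used (Unique-complete distinct refl zero)
    where
    open EBColours (EB-colours uv)
    u∈VB : VB G ψ u
    u∈VB = v , inj₁ uv
    v∈VB : VB G ψ v
    v∈VB = u , inj₂ uv
    zero-used : zero ∈ₗ (cᵤ ∷ cᵥ ∷ i ∷ j ∷ []) → InX u ⊎ InX v
    zero-used (here 0≡cᵤ)                         = inj₁ (u∈VB , inj₁ (trans ψu≡cᵤ (cong just (sym 0≡cᵤ))))
    zero-used (there (here 0≡cᵥ))                 = inj₂ (v∈VB , inj₁ (trans ψv≡cᵥ (cong just (sym 0≡cᵥ))))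
    zero-used (there (there (here 0≡i)))          = inj₁ (u∈VB , inj₂ (subst (λ c → InU G ψ c u) (sym 0≡i) u∈Uᵢ))
    zero-used (there (there (there (here 0≡j))))  = inj₂ (v∈VB , inj₂ (subst (λ c → InU G ψ c v) (sym 0≡j) v∈Uⱼ))

  X : Fin n → Bool
  X v = ⌊ InX? v ⌋

  Link : Fin n → Fin n → Set
  Link v x = InX v × Adj G v x × ψ x ≡ nothing

  Link? : ∀ v x → Dec (Link v x)
  Link? v x = InX? v ×-dec adj? G v x ×-dec coloured? x nothing

  link : Fin n → Fin n → Bool
  link v x = ⌊ Link? v x ⌋

  InX⇒2≤links : ∀ {v} → InX v → 2 ≤ count (link v)
  InX⇒2≤links {v} v∈X = let u , vu = VB⇒EB (proj₁ v∈X) in two-links vu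
    where
    linked : ∀ {u w} → EB G ψ v u → CommonNeighbour G v u w → link v w ≡ true
    linked {w = w} vu common@(v~w , _) =
      fromWitness≡ (Link? v w) (v∈X , v~w , EB-common-neighbour-uncoloured vu common)
    two-links : ∀ {u} → EB G ψ v u → 2 ≤ count (link v)
    two-links vu@(v~u , _ , _ , _ , v∈Uᵢ , _) =
      let w , w′ , w≢w′ , w-common , w′-common =
            two-common-neighbours G v~u (<-trans (s≤s (s≤s (s≤s z≤n))) (InU⇒5<degree v∈Uᵢ))
      in length≤count ((w≢w′ ∷ []) ∷ [] ∷ []) (linked vu w-common ∷ linked vu w′-common ∷ [])

  uncoloured⇒zero-neighbour : ∀ {x} → ψ x ≡ nothing → ∃[ a ] Adj G x a × ψ a ≡ just zero
  uncoloured⇒zero-neighbour {x} ψx≡nothing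
    with palette-full (subst (_≤ 5) (sym (uncoloured⇒degree≡4 x ψx≡nothing)) (n≤1+n 4)) zero
  ... | inj₁ ψx≡0   = contradiction (trans (sym ψx≡nothing) ψx≡0) λ ()
  ... | inj₂ zero-neighbour = zero-neighbour

  2+links≤degree : ∀ {x a} → Adj G x a → ψ a ≡ just zero → 2 < degree G x →
                   2 + count (λ v → link v x) ≤ degree G x
  2+links≤degree {x} {a} x~a ψa≡0 2<deg =
    let w , w′ , w≢w′ , (x~w , a~w) , (x~w′ , a~w′) = two-common-neighbours G x~a 2<deg
    in length+count≤count ((w≢w′ ∷ []) ∷ [] ∷ []) (adjacent x~w ∷ adjacent x~w′ ∷ [])
                          (unlinked a~w ∷ unlinked a~w′ ∷ []) linked⇒adjacent
    where
    adjacent : ∀ {v} → Adj G x v → ⌊ adj? G x v ⌋ ≡ true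
    adjacent {v} = fromWitness≡ (adj? G x v)
    unlinked : ∀ {v} → Adj G a v → link v x ≢ true
    unlinked {v} a~v linked =
      InX⇒no-zero-neighbour (proj₁ (toWitness≡ (Link? v x) linked)) (Adj-sym G a~v) ψa≡0
    linked⇒adjacent : ∀ v → link v x ≡ true → ⌊ adj? G x v ⌋ ≡ true
    linked⇒adjacent v linked = adjacent (Adj-sym G (proj₁ (proj₂ (toWitness≡ (Link? v x) linked))))

  uncoloured⇒links≤2 : ∀ {x} → ψ x ≡ nothing → count (λ v → link v x) ≤ 2
  uncoloured⇒links≤2 {x} ψx≡nothing =
    let a , x~a , ψa≡0 = uncoloured⇒zero-neighbour ψx≡nothing
    in +-cancelˡ-≤ 2 _ _ (subst (2 + count (λ v → link v x) ≤_) deg≡4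
                           (2+links≤degree x~a ψa≡0 (subst (2 <_) (sym deg≡4) (s≤s (s≤s (s≤s z≤n))))))
    where
    deg≡4 : degree G x ≡ 4
    deg≡4 = uncoloured⇒degree≡4 x ψx≡nothing

  vertex-cover : ∃[ X ] (VertexCoverB G ψ X × count X ≤ uncolored ψ)
  vertex-cover = X , (X⊆VB , EB-covered) , double-counting 2 X (is-nothing ∘ ψ) link link⇒uncoloured rows columns
    where
    X⊆VB : ∀ v → X v ≡ true → VB G ψ v
    X⊆VB v = proj₁ ∘ toWitness≡ (InX? v)
    EB-covered : ∀ u v → EB G ψ u v → X u ≡ true ⊎ X v ≡ true
    EB-covered u v = Sum.map (fromWitness≡ (InX? u)) (fromWitness≡ (InX? v)) ∘ EB⇒InX
    link⇒uncoloured : ∀ v x → link v x ≡ true → is-nothing (ψ x) ≡ true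
    link⇒uncoloured v x = cong is-nothing ∘ proj₂ ∘ proj₂ ∘ toWitness≡ (Link? v x)
    rows : ∀ v → X v ≡ true → 2 ≤ count (link v)
    rows v = InX⇒2≤links ∘ toWitness≡ (InX? v)
    columns : ∀ x → is-nothing (ψ x) ≡ true → count (λ v → link v x) ≤ 2
    columns x = uncoloured⇒links≤2 ∘ is-nothing⇒≡nothing (ψ x)

lemma3 : ∀ {n} (G : Triangulation n)
         → ¬ HasSmallIDS G
         → (∀ n′ → n′ < n → (H : Triangulation n′) → HasSmallIDS H)
         → (ψ : Coloring n)
         → Proper G ψ
         → (∀ v → ψ v ≡ nothing → degree G v ≡ 4)
         → (∀ v → 3 ≤ psiSize G ψ v)
         → (∀ v → degree G v ≤ 5 → psiSize G ψ v ≡ 4)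
         → ∃[ X ] (VertexCoverB G ψ X × count X ≤ uncolored ψ)
lemma3 G _ _ ψ proper uncoloured⇒degree≡4 _ small-degree⇒psi≡4 =
  VertexCover.vertex-cover G ψ proper uncoloured⇒degree≡4 small-degree⇒psi≡4
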